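{- Let $d$ be a squarefree integer, $d\neq 0,1$, let $p>3$ be a prime with $\gcd(p,d)=p$ (i.e. $p\mid d$), and let $a,b\in\mathbb{Z}$. Then: (i) $Im\left((a+b\sqrt{d})^p\right)=0$ if and only if $b=0$; (ii) $Re\left((a+b\sqrt{d})^p\right)=0$ if and only if $a=0$.
   Context: For an element $a+b\sqrt{d}$ of $K=\mathbb{Q}(\sqrt{d})$ with $a,b\in\mathbb{Q}$, its "real part" is $Re(a+b\sqrt{d})=a$ and its "imaginary part" is $Im(a+b\sqrt{d})=b$ (these are defined this way for every squarefree $d$, positive or negative). -}

module Defs where

open import Data.Nat as ℕ using (ℕ; zero; suc)
open import Data.Nat.Divisibility as ℕD using ()
open import Data.Integer using (ℤ; _+_; _*_; +_; ∣_∣)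
open import Data.Product using (_×_; _,_; proj₁; proj₂)
open import Relation.Binary.PropositionalEquality using (_≡_)

SquareFree : ℤ → Set
SquareFree d = ∀ (n : ℕ) → (n ℕ.* n) ℕD.∣ ∣ d ∣ → n ≡ 1

-- Elements a + b√d of ℤ[√d] ⊆ ℚ(√d), represented by the pair (a , b).
ZSqrt : Set
ZSqrt = ℤ × ℤ

Re : ZSqrt → ℤ
Re = proj₁

Im : ZSqrt → ℤ
Im = proj₂

-- multiplication in ℤ[√d]: (a + b√d)(c + e√d) = (ac + d be) + (ae + bc)√d
mulD : ℤ → ZSqrt → ZSqrt → ZSqrt
mulD d (a , b) (c , e) = (a * c + d * (b * e)) , (a * e + b * c)

powD : ℤ → ZSqrt → ℕ → ZSqrt
powD d x zero = (+ 1 , + 0)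
powD d x (suc n) = mulD d x (powD d x n)

-- Write x = a + b√d and p = 2m + 1.  Modulo d², Im (x ^ p) = b (p a^(p-1) + C(p,3) a^(p-3) b² d),
-- and p divides both d and C(p,3); so Im (x ^ p) = 0 with b ≠ 0 forces p ∣ a.  Once p ∣ a,
-- every term of Im (x ^ p) other than b^p d^m is divisible by p^(m+1), while p^(m+1) ∤ b^p d^m
-- unless p ∣ b, because d/p is prime to p by squarefreeness.  Hence x = p y with Im (y ^ p) = 0,
-- and descent on ∣ b ∣ gives b = 0.  Part (ii) reduces to part (i): x √d = d b + a √d and
-- (x √d) ^ p = d^m (x ^ p) √d, so Im ((x √d) ^ p) = d^m Re (x ^ p).

module Submission where

open import Defs
open import Data.Nat using (ℕ; _>_)
open import Data.Nat.Primality using (Prime)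
open import Data.Integer using (ℤ; +_)
open import Data.Integer.Divisibility using (_∣_)
open import Data.Product using (_×_; _,_)
open import Function.Bundles using (_⇔_)
open import Relation.Binary.PropositionalEquality using (_≡_)
open import Relation.Nullary using (¬_)

open import Data.Nat as ℕ using (zero; suc; _<_; s≤s)
import Data.Nat.Properties as ℕ
open import Data.Nat.DivMod using (_%_; _/_; m≡m%n+[m/n]*n; m%n<n)
open import Data.Nat.Divisibility using (divides; _∣0; ∣1⇒≡1; >⇒∤)
  renaming (_∣_ to _∣ℕ_)
open import Data.Nat.Combinatorics using (_C_; nC1≡n; nCk+nC[k+1]≡[n+1]C[k+1])
open import Data.Nat.Primality using (euclidsLemma; prime⇒irreducible; prime⇒nonTrivial)
open import Data.Nat.Induction using (<-wellFounded)
import Data.Nat.Tactic.RingSolver as ℕ-Solver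
open import Data.Integer using (0ℤ; 1ℤ; _+_; _*_; _^_; ∣_∣; _≟_)
open import Data.Integer.Properties
  using (abs-*; pos-*; *-comm; *-zeroʳ; ∣i∣≡0⇒i≡0; i*j≡0⇒i≡0∨j≡0; i^n≡0⇒i≡0)
import Data.Integer.Divisibility.Signed as Signed
open import Data.Integer.Tactic.RingSolver using (solve-∀)
open import Data.Product using (proj₁; proj₂; ∃; ∃₂)
open import Data.Sum using (_⊎_; inj₁; inj₂; [_,_]′)
open import Data.Empty using (⊥-elim)
open import Function using (id; _∘_)
open import Function.Bundles using (mk⇔)
open import Induction.WellFounded using (Acc; acc)
open import Relation.Binary.PropositionalEquality
  using (_≢_; refl; sym; trans; cong; cong₂; subst; module ≡-Reasoning)
open import Relation.Nullary using (yes; no)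

i*j≡0⇒j≡0 : ∀ {i j} → i ≢ 0ℤ → i * j ≡ 0ℤ → j ≡ 0ℤ
i*j≡0⇒j≡0 {i} i≢0 ij≡0 = [ ⊥-elim ∘ i≢0 , id ]′ (i*j≡0⇒i≡0∨j≡0 i ij≡0)

+*≡0⇒∣ : ∀ {k i j} → i + k * j ≡ 0ℤ → k ∣ i
+*≡0⇒∣ {k} {i} {j} i+kj≡0 =
  Signed.∣⇒∣ᵤ (Signed.∣m+n∣n⇒∣m {m = i} k∣i+kj (Signed.∣m⇒∣m*n j Signed.∣-refl))
  where
  k∣i+kj : k Signed.∣ i + k * j
  k∣i+kj = subst (k Signed.∣_) (sym i+kj≡0) (Signed.divides 0ℤ refl)

module _ {p : ℕ} (p-prime : Prime p) where

  prime∣*⇒∣⊎∣ : ∀ i j → + p ∣ i * j → (+ p ∣ i) ⊎ (+ p ∣ j)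
  prime∣*⇒∣⊎∣ i j p∣ij =
    euclidsLemma ∣ i ∣ ∣ j ∣ p-prime (subst (p ∣ℕ_) (abs-* i j) p∣ij)

  prime∣^⇒∣ : ∀ i n → + p ∣ i ^ n → + p ∣ i
  prime∣^⇒∣ i zero    p∣1    =
    ⊥-elim (ℕ.nonTrivial⇒≢1 {{prime⇒nonTrivial p-prime}} (∣1⇒≡1 p∣1))
  prime∣^⇒∣ i (suc n) p∣iⁿ⁺¹ =
    [ id , prime∣^⇒∣ i n ]′ (prime∣*⇒∣⊎∣ i (i ^ n) p∣iⁿ⁺¹)

C-absorption : ∀ n k → suc k ℕ.* (suc n C suc k) ≡ suc n ℕ.* (n C k)
C-absorption zero    zero    = refl
C-absorption zero    (suc k) = ℕ.*-zeroʳ (2 ℕ.+ k)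
C-absorption (suc n) zero    =
  trans (ℕ.*-identityˡ ((2 ℕ.+ n) C 1))
        (trans (nC1≡n (2 ℕ.+ n)) (sym (ℕ.*-identityʳ (2 ℕ.+ n))))
C-absorption (suc n) (suc k) = begin
  (2 ℕ.+ k) ℕ.* ((2 ℕ.+ n) C (2 ℕ.+ k))
    ≡⟨ cong ((2 ℕ.+ k) ℕ.*_) (sym (nCk+nC[k+1]≡[n+1]C[k+1] (suc n) (suc k))) ⟩
  (2 ℕ.+ k) ℕ.* (suc n C suc k ℕ.+ suc n C (2 ℕ.+ k))
    ≡⟨ regroup (suc n C suc k) (suc n C (2 ℕ.+ k)) k ⟩
  suc k ℕ.* (suc n C suc k) ℕ.+ (2 ℕ.+ k) ℕ.* (suc n C (2 ℕ.+ k)) ℕ.+ suc n C suc k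
    ≡⟨ cong₂ (λ x y → x ℕ.+ y ℕ.+ suc n C suc k) (C-absorption n k) (C-absorption n (suc k)) ⟩
  suc n ℕ.* (n C k) ℕ.+ suc n ℕ.* (n C suc k) ℕ.+ suc n C suc k
    ≡⟨ cong (ℕ._+ suc n C suc k) (sym (ℕ.*-distribˡ-+ (suc n) (n C k) (n C suc k))) ⟩
  suc n ℕ.* (n C k ℕ.+ n C suc k) ℕ.+ suc n C suc k
    ≡⟨ cong (λ x → suc n ℕ.* x ℕ.+ suc n C suc k) (nCk+nC[k+1]≡[n+1]C[k+1] n k) ⟩
  suc n ℕ.* (suc n C suc k) ℕ.+ suc n C suc k
    ≡⟨ ℕ.+-comm (suc n ℕ.* (suc n C suc k)) _ ⟩
  (2 ℕ.+ n) ℕ.* (suc n C suc k) ∎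
  where
  open ≡-Reasoning
  regroup : ∀ x y k → (2 ℕ.+ k) ℕ.* (x ℕ.+ y) ≡ suc k ℕ.* x ℕ.+ (2 ℕ.+ k) ℕ.* y ℕ.+ x
  regroup = ℕ-Solver.solve-∀

prime∣C : ∀ {n k} → Prime (suc n) → k < n → suc n ∣ℕ suc n C suc k
prime∣C {n} {k} p-prime k<n
  with euclidsLemma (suc k) (suc n C suc k) p-prime
         (divides (n C k) (trans (C-absorption n k) (ℕ.*-comm (suc n) (n C k))))
... | inj₁ p∣1+k = ⊥-elim (>⇒∤ (s≤s k<n) p∣1+k)
... | inj₂ p∣C   = p∣C

odd-prime : ∀ {p} → Prime p → p > 2 → ∃ λ m → p ≡ suc (m ℕ.* 2)
odd-prime {p} p-prime p>2 with p % 2 | m≡m%n+[m/n]*n p 2 | m%n<n p 2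
... | 0 | p≡[p/2]*2 | _ with prime⇒irreducible p-prime (divides (p / 2) p≡[p/2]*2)
...   | inj₁ ()
...   | inj₂ refl = ⊥-elim (ℕ.<-irrefl refl p>2)
odd-prime {p} p-prime p>2 | 1 | p≡1+[p/2]*2 | _ = p / 2 , p≡1+[p/2]*2
odd-prime {p} p-prime p>2 | suc (suc _) | _ | s≤s (s≤s ())

infixr 7 _·_

_·_ : ℤ → ZSqrt → ZSqrt
k · (a , b) = k * a , k * b

-- multiplication by √d: (a + b√d) √d = d b + a √d
mul√ : ℤ → ZSqrt → ZSqrt
mul√ d (a , b) = d * b , a

mulD-· : ∀ d k l x y → mulD d (k · x) (l · y) ≡ (k * l) · mulD d x y
mulD-· d k l (a , b) (c , e) = cong₂ _,_ (re d k l a b c e) (im k l a b c e)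
  where
  re : ∀ d k l a b c e → k * a * (l * c) + d * (k * b * (l * e)) ≡ k * l * (a * c + d * (b * e))
  re = solve-∀
  im : ∀ k l a b c e → k * a * (l * e) + k * b * (l * c) ≡ k * l * (a * e + b * c)
  im = solve-∀

powD-· : ∀ d k x n → powD d (k · x) n ≡ k ^ n · powD d x n
powD-· d k x zero    = refl
powD-· d k x (suc n) = trans (cong (mulD d (k · x)) (powD-· d k x n)) (mulD-· d k (k ^ n) x _)

Im-powD-·≡0 : ∀ {d k x n} → k ≢ 0ℤ → Im (powD d (k · x) n) ≡ 0ℤ → Im (powD d x n) ≡ 0ℤ
Im-powD-·≡0 {d} {k} {x} {n} k≢0 Im≡0 =
  i*j≡0⇒j≡0 kⁿ≢0 (trans (sym (cong Im (powD-· d k x n))) Im≡0)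
  where
  kⁿ≢0 : k ^ n ≢ 0ℤ
  kⁿ≢0 kⁿ≡0 = k≢0 (i^n≡0⇒i≡0 k n kⁿ≡0)

Im-powD-rational : ∀ d a n → Im (powD d (a , 0ℤ) n) ≡ 0ℤ
Im-powD-rational d a zero    = refl
Im-powD-rational d a (suc n) rewrite Im-powD-rational d a n = cong (_+ 0ℤ) (*-zeroʳ a)

mulD-mul√ : ∀ d k x y → mulD d (mul√ d x) (k · y) ≡ mul√ d (k · mulD d x y)
mulD-mul√ d k (a , b) (c , e) = cong₂ _,_ (re d k a b c e) (im d k a b c e)
  where
  re : ∀ d k a b c e → d * b * (k * c) + d * (a * (k * e)) ≡ d * (k * (a * e + b * c))
  re = solve-∀
  im : ∀ d k a b c e → d * b * (k * e) + a * (k * c) ≡ k * (a * c + d * (b * e))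
  im = solve-∀

mulD-mul√² : ∀ d k x y →
  mulD d (mul√ d x) (mulD d (mul√ d x) (k · y)) ≡ (d * k) · mulD d x (mulD d x y)
mulD-mul√² d k (a , b) (c , e) = cong₂ _,_ (re d k a b c e) (im d k a b c e)
  where
  re : ∀ d k a b c e →
    d * b * (d * b * (k * c) + d * (a * (k * e))) + d * (a * (d * b * (k * e) + a * (k * c)))
    ≡ d * k * (a * (a * c + d * (b * e)) + d * (b * (a * e + b * c)))
  re = solve-∀
  im : ∀ d k a b c e →
    d * b * (d * b * (k * e) + a * (k * c)) + a * (d * b * (k * c) + d * (a * (k * e)))
    ≡ d * k * (a * (a * e + b * c) + b * (a * c + d * (b * e)))
  im = solve-∀

powD-mul√-even : ∀ d x m → powD d (mul√ d x) (m ℕ.* 2) ≡ d ^ m · powD d x (m ℕ.* 2)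
powD-mul√-even d x zero    = refl
powD-mul√-even d x (suc m) =
  trans (cong (λ y → mulD d (mul√ d x) (mulD d (mul√ d x) y)) (powD-mul√-even d x m))
        (mulD-mul√² d (d ^ m) x _)

Im-powD-mul√ : ∀ {p m} d x → p ≡ suc (m ℕ.* 2) →
  Im (powD d (mul√ d x) p) ≡ d ^ m * Re (powD d x p)
Im-powD-mul√ {m = m} d x refl =
  cong Im (trans (cong (mulD d (mul√ d x)) (powD-mul√-even d x m)) (mulD-mul√ d (d ^ m) x _))

powD-mod-d² : ∀ d a b n → ∃₂ λ U W → powD d (a , b) (3 ℕ.+ n) ≡
  ( a ^ (3 ℕ.+ n) + + ((3 ℕ.+ n) C 2) * a ^ (1 ℕ.+ n) * b * b * d + d * d * U
  , b * (+ (3 ℕ.+ n) * a ^ (2 ℕ.+ n) + + ((3 ℕ.+ n) C 3) * a ^ n * b * b * d + d * d * W))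
powD-mod-d² d a b zero = 0ℤ , 0ℤ , cong₂ _,_ (re a b d) (im a b d)
  where
  re : ∀ a b d →
    a * (a * (a * 1ℤ + d * (b * 0ℤ)) + d * (b * (a * 0ℤ + b * 1ℤ)))
      + d * (b * (a * (a * 0ℤ + b * 1ℤ) + b * (a * 1ℤ + d * (b * 0ℤ))))
    ≡ a * (a * (a * 1ℤ)) + + 3 * (a * 1ℤ) * b * b * d + d * d * 0ℤ
  re = solve-∀
  im : ∀ a b d →
    a * (a * (a * 0ℤ + b * 1ℤ) + b * (a * 1ℤ + d * (b * 0ℤ)))
      + b * (a * (a * 1ℤ + d * (b * 0ℤ)) + d * (b * (a * 0ℤ + b * 1ℤ)))
    ≡ b * (+ 3 * (a * (a * 1ℤ)) + 1ℤ * 1ℤ * b * b * d + d * d * 0ℤ)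
  im = solve-∀
powD-mod-d² d a b (suc n) with powD-mod-d² d a b n
... | U , W , powD≡ = U′ , W′ ,
  trans (cong (mulD d (a , b)) powD≡)
    (trans (cong₂ _,_ (re a aⁿ b d (+ k) c₂ c₃ U W) (im a aⁿ b d (+ k) c₂ c₃ U W))
           (cong₂ expansion (trans (cong (ℕ._+ k C 2) (sym (nC1≡n k)))
                                   (nCk+nC[k+1]≡[n+1]C[k+1] k 1))
                            (nCk+nC[k+1]≡[n+1]C[k+1] k 2)))
  where
  k = 3 ℕ.+ n
  aⁿ = a ^ n
  c₂ = + (k C 2)
  c₃ = + (k C 3)
  U′ = a * U + c₃ * aⁿ * b * b * b * b + d * b * b * W
  W′ = a * W + U
  expansion : ℕ → ℕ → ZSqrt
  expansion c₂′ c₃′ =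
    ( a ^ (1 ℕ.+ k) + + c₂′ * a ^ (2 ℕ.+ n) * b * b * d + d * d * U′
    , b * (+ (1 ℕ.+ k) * a ^ k + + c₃′ * a ^ (1 ℕ.+ n) * b * b * d + d * d * W′))
  re : ∀ a aⁿ b d k c₂ c₃ U W →
    a * (a * (a * (a * aⁿ)) + c₂ * (a * aⁿ) * b * b * d + d * d * U)
      + d * (b * (b * (k * (a * (a * aⁿ)) + c₃ * aⁿ * b * b * d + d * d * W)))
    ≡ a * (a * (a * (a * aⁿ))) + (k + c₂) * (a * (a * aⁿ)) * b * b * d
      + d * d * (a * U + c₃ * aⁿ * b * b * b * b + d * b * b * W)
  re = solve-∀
  im : ∀ a aⁿ b d k c₂ c₃ U W →
    a * (b * (k * (a * (a * aⁿ)) + c₃ * aⁿ * b * b * d + d * d * W))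
      + b * (a * (a * (a * aⁿ)) + c₂ * (a * aⁿ) * b * b * d + d * d * U)
    ≡ b * ((1ℤ + k) * (a * (a * (a * aⁿ))) + (c₂ + c₃) * (a * aⁿ) * b * b * d
           + d * d * (a * W + U))
  im = solve-∀

powD-odd-mod-Pᵐ⁺¹ : ∀ P e α b m → ∃₂ λ U V →
  powD (e * P) (α * P , b) (suc (m ℕ.* 2))
    ≡ (P * P ^ m * U , b * b ^ (m ℕ.* 2) * (P ^ m * e ^ m) + P * P ^ m * V)
powD-odd-mod-Pᵐ⁺¹ P e α b zero = α , 0ℤ , cong₂ _,_ (re P e α b) (im P e α b)
  where
  re : ∀ P e α b → α * P * 1ℤ + e * P * (b * 0ℤ) ≡ P * 1ℤ * α
  re = solve-∀
  im : ∀ P e α b → α * P * 0ℤ + b * 1ℤ ≡ b * 1ℤ * (1ℤ * 1ℤ) + P * 1ℤ * 0ℤ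
  im = solve-∀
powD-odd-mod-Pᵐ⁺¹ P e α b (suc m) with powD-odd-mod-Pᵐ⁺¹ P e α b m
... | U , V , powD≡ = U′ , V′ ,
  trans (cong (λ y → mulD (e * P) (α * P , b) (mulD (e * P) (α * P , b) y)) powD≡)
        (cong₂ _,_ (re P e α b b²ᵐ Pᵐ eᵐ U V) (im P e α b b²ᵐ Pᵐ eᵐ U V))
  where
  b²ᵐ = b ^ (m ℕ.* 2)
  Pᵐ = P ^ m
  eᵐ = e ^ m
  U′ = α * α * P * U + + 2 * α * e * b * (b * b²ᵐ * eᵐ + P * V) + e * b * b * U
  V′ = α * α * (b * b²ᵐ * eᵐ + P * V) + e * b * b * V + + 2 * α * b * U
  re : ∀ P e α b b²ᵐ Pᵐ eᵐ U V →
    let R = P * Pᵐ * U ; I = b * b²ᵐ * (Pᵐ * eᵐ) + P * Pᵐ * V in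
    α * P * (α * P * R + e * P * (b * I)) + e * P * (b * (α * P * I + b * R))
    ≡ P * (P * Pᵐ) * (α * α * P * U + + 2 * α * e * b * (b * b²ᵐ * eᵐ + P * V) + e * b * b * U)
  re = solve-∀
  im : ∀ P e α b b²ᵐ Pᵐ eᵐ U V →
    let R = P * Pᵐ * U ; I = b * b²ᵐ * (Pᵐ * eᵐ) + P * Pᵐ * V in
    α * P * (α * P * I + b * R) + b * (α * P * R + e * P * (b * I))
    ≡ b * (b * (b * b²ᵐ)) * ((P * Pᵐ) * (e * eᵐ))
      + P * (P * Pᵐ) * (α * α * (b * b²ᵐ * eᵐ + P * V) + e * b * b * V + + 2 * α * b * U)
  im = solve-∀

Im-powD≡0⇒p∣a : ∀ {p e a b} → Prime p → p > 3 → b ≢ 0ℤ →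
  Im (powD (e * + p) (a , b) p) ≡ 0ℤ → + p ∣ a
Im-powD≡0⇒p∣a {p@(suc (suc (suc n)))} {e} {a} {b} p-prime (s≤s (s≤s (s≤s 0<n))) b≢0 Im≡0
  with powD-mod-d² (e * + p) a b n | prime∣C {k = 2} p-prime (ℕ.+-monoʳ-< 2 0<n)
... | U , W , powD≡ | divides c pC3≡c*p =
  prime∣^⇒∣ p-prime a (2 ℕ.+ n)
    (+*≡0⇒∣ {P} {a ^ (2 ℕ.+ n)} (i*j≡0⇒j≡0 P≢0 (trans (sym factor) bracket≡0)))
  where
  P = + p
  P≢0 : P ≢ 0ℤ
  P≢0 ()
  bracket = P * a ^ (2 ℕ.+ n) + + (p C 3) * a ^ n * b * b * (e * P) + e * P * (e * P) * W
  bracket≡0 : bracket ≡ 0ℤ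
  bracket≡0 = i*j≡0⇒j≡0 b≢0 (trans (sym (cong Im powD≡)) Im≡0)
  identity : ∀ P A C aⁿ b e W →
    P * A + C * P * aⁿ * b * b * (e * P) + e * P * (e * P) * W
    ≡ P * (A + P * (C * aⁿ * b * b * e + e * e * W))
  identity = solve-∀
  factor : bracket ≡ P * (a ^ (2 ℕ.+ n) + P * (+ c * a ^ n * b * b * e + e * e * W))
  factor = trans
    (cong (λ C → P * a ^ (2 ℕ.+ n) + C * a ^ n * b * b * (e * P) + e * P * (e * P) * W)
          (trans (cong +_ pC3≡c*p) (pos-* c p)))
    (identity P (a ^ (2 ℕ.+ n)) (+ c) (a ^ n) b e W)

Im-powD≡0⇒p∣b : ∀ {p m e α b} → Prime p → p ≡ suc (m ℕ.* 2) → ¬ (+ p ∣ e) →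
  Im (powD (e * + p) (α * + p , b) p) ≡ 0ℤ → + p ∣ b
Im-powD≡0⇒p∣b {m = m} {e} {α} {b} p-prime refl p∤e Im≡0 =
  [ prime∣^⇒∣ p-prime b (suc (m ℕ.* 2)) , ⊥-elim ∘ p∤e ∘ prime∣^⇒∣ p-prime e m ]′
    (prime∣*⇒∣⊎∣ p-prime (b ^ suc (m ℕ.* 2)) (e ^ m) p∣bᵖeᵐ)
  where
  P = + suc (m ℕ.* 2)
  Pᵐ≢0 : P ^ m ≢ 0ℤ
  Pᵐ≢0 Pᵐ≡0 with i^n≡0⇒i≡0 P m Pᵐ≡0
  ... | ()
  expansion = powD-odd-mod-Pᵐ⁺¹ P e α b m
  V = proj₁ (proj₂ expansion)
  Im≡0′ : b * b ^ (m ℕ.* 2) * (P ^ m * e ^ m) + P * P ^ m * V ≡ 0ℤ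
  Im≡0′ = trans (sym (cong Im (proj₂ (proj₂ expansion)))) Im≡0
  identity : ∀ b b²ᵐ Pᵐ eᵐ P V →
    b * b²ᵐ * (Pᵐ * eᵐ) + P * Pᵐ * V ≡ Pᵐ * (b * b²ᵐ * eᵐ + P * V)
  identity = solve-∀
  p∣bᵖeᵐ : P ∣ b ^ suc (m ℕ.* 2) * e ^ m
  p∣bᵖeᵐ = +*≡0⇒∣ {P} {b ^ suc (m ℕ.* 2) * e ^ m}
    (i*j≡0⇒j≡0 Pᵐ≢0 (trans (sym (identity b (b ^ (m ℕ.* 2)) (P ^ m) (e ^ m) P V)) Im≡0′))

module _ {p : ℕ} (p-prime : Prime p) (p>3 : p > 3) (e : ℤ) (p∤e : ¬ (+ p ∣ e)) where

  private
    d = e * + p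
    p-odd = odd-prime p-prime (ℕ.<-trans (ℕ.n<1+n 2) p>3)
    m = proj₁ p-odd
    p≡2m+1 = proj₂ p-odd
    +p≢0 : + p ≢ 0ℤ
    +p≢0 +p≡0 = ℕ.n≮0 (subst (3 <_) (cong ∣_∣ +p≡0) p>3)

  Im-powD≡0⇒b≡0 : ∀ {a b} → Acc _<_ ∣ b ∣ → Im (powD d (a , b) p) ≡ 0ℤ → b ≡ 0ℤ
  Im-powD≡0⇒b≡0 {a} {b} (acc smaller) Im≡0 with b ≟ 0ℤ
  ... | yes b≡0 = b≡0
  ... | no  b≢0
    with Signed.∣ᵤ⇒∣ {+ p} {a} (Im-powD≡0⇒p∣a {e = e} {a} {b} p-prime p>3 b≢0 Im≡0)
  ... | Signed.divides α refl
    with Signed.∣ᵤ⇒∣ {+ p} {b}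
           (Im-powD≡0⇒p∣b {m = m} {e} {α} {b} p-prime p≡2m+1 p∤e Im≡0)
  ... | Signed.divides β refl =
    cong (_* + p) (Im-powD≡0⇒b≡0 {α} {β} (smaller ∣β∣<∣b∣) Im[α,β]≡0)
    where
    ∣β∣≢0 : ∣ β ∣ ≢ 0
    ∣β∣≢0 ∣β∣≡0 = b≢0 (cong (_* + p) (∣i∣≡0⇒i≡0 {β} ∣β∣≡0))
    ∣β∣<∣b∣ : ∣ β ∣ < ∣ β * + p ∣
    ∣β∣<∣b∣ = subst (∣ β ∣ <_) (sym (abs-* β (+ p)))
      (ℕ.m<m*n ∣ β ∣ p {{ℕ.≢-nonZero ∣β∣≢0}}
               (ℕ.nonTrivial⇒n>1 p {{prime⇒nonTrivial p-prime}}))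
    Im[α,β]≡0 : Im (powD d (α , β) p) ≡ 0ℤ
    Im[α,β]≡0 = Im-powD-·≡0 {d} {+ p} {α , β} {p} +p≢0
      (subst (λ x → Im (powD d x p) ≡ 0ℤ) (cong₂ _,_ (*-comm α (+ p)) (*-comm β (+ p))) Im≡0)

  Im-powD≡0⇔b≡0 : ∀ a b → Im (powD d (a , b) p) ≡ 0ℤ ⇔ b ≡ 0ℤ
  Im-powD≡0⇔b≡0 a b =
    mk⇔ (Im-powD≡0⇒b≡0 {a} {b} (<-wellFounded ∣ b ∣)) (λ { refl → Im-powD-rational d a p })

  Re-powD≡0⇔a≡0 : ∀ a b → Re (powD d (a , b) p) ≡ 0ℤ ⇔ a ≡ 0ℤ
  Re-powD≡0⇔a≡0 a b = mk⇔
    (λ Re≡0 → Im-powD≡0⇒b≡0 {d * b} {a} (<-wellFounded ∣ a ∣) (begin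
      Im (powD d (mul√ d (a , b)) p) ≡⟨ Im-powD-mul√ {m = m} d (a , b) p≡2m+1 ⟩
      d ^ m * Re (powD d (a , b) p)  ≡⟨ cong (d ^ m *_) Re≡0 ⟩
      d ^ m * 0ℤ                     ≡⟨ *-zeroʳ (d ^ m) ⟩
      0ℤ                             ∎))
    (λ { refl → i*j≡0⇒j≡0 dᵐ≢0 (begin
      d ^ m * Re (powD d (0ℤ , b) p)  ≡⟨ Im-powD-mul√ {m = m} d (0ℤ , b) p≡2m+1 ⟨
      Im (powD d (d * b , 0ℤ) p)      ≡⟨ Im-powD-rational d (d * b) p ⟩
      0ℤ                              ∎) })
    where
    open ≡-Reasoning
    dᵐ≢0 : d ^ m ≢ 0ℤ
    dᵐ≢0 dᵐ≡0 with i*j≡0⇒i≡0∨j≡0 e (i^n≡0⇒i≡0 d m dᵐ≡0)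
    ... | inj₁ refl = p∤e (p ∣0)
    ... | inj₂ +p≡0 = +p≢0 +p≡0

squareFree-*⇒∤ : ∀ {e p} → SquareFree (e * + p) → p ≢ 1 → ¬ (+ p ∣ e)
squareFree-*⇒∤ {e} {p} squareFree p≢1 (divides q ∣e∣≡q*p) =
  p≢1 (squareFree p (divides q (begin
    ∣ e * + p ∣     ≡⟨ abs-* e (+ p) ⟩
    ∣ e ∣ ℕ.* p     ≡⟨ cong (ℕ._* p) ∣e∣≡q*p ⟩
    q ℕ.* p ℕ.* p   ≡⟨ ℕ.*-assoc q p p ⟩
    q ℕ.* (p ℕ.* p) ∎)))
  where open ≡-Reasoning

lemma3p9 : (d : ℤ) → SquareFree d → ¬ (d ≡ + 0) → ¬ (d ≡ + 1)
    → (p : ℕ) → Prime p → p > 3 → (+ p) ∣ d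
    → (a b : ℤ)
    → ((Im (powD d (a , b) p) ≡ + 0) ⇔ (b ≡ + 0))
    × ((Re (powD d (a , b) p) ≡ + 0) ⇔ (a ≡ + 0))
lemma3p9 d squareFree _ _ p p-prime p>3 p∣d a b with Signed.∣ᵤ⇒∣ {+ p} {d} p∣d
... | Signed.divides e refl =
  Im-powD≡0⇔b≡0 p-prime p>3 e p∤e a b , Re-powD≡0⇔a≡0 p-prime p>3 e p∤e a b
  where
  p∤e : ¬ (+ p ∣ e)
  p∤e = squareFree-*⇒∤ {e} squareFree (ℕ.nonTrivial⇒≢1 {{prime⇒nonTrivial p-prime}})
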